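{- Let $G$ be a graph and let $(v_0,G_1,v_1,\ldots,v_{n-1},G_n)$ with $n\ge1$ be a play of the flipper game of radius $2$ and width $2$ on $G$ such that for every possible choice of the runner's position $v_n$ (i.e. every vertex reachable from $v_{n-1}$ by a path of length at most $2$ in $G_{n-1}$), $v_n$ is an isolated vertex of $G_n$. Let $S$ be the set of all isolated vertices of $G_n$. Then (i) $|S|\ge 2$; and (ii) if $|S|=2$, then $G_{n-1}[S]$ is a connected component of $G_{n-1}$.
   Context: All graphs are finite, simple. For $A,B\subseteq V(G)$, $G\oplus(A,B)$ is the graph on $V(G)$ in which the adjacency of distinct $u,v$ is toggled exactly when $(u,v)\in(A\times B)\cup(B\times A)$; for a collection $\mathcal{S}$ of pairs, $G\oplus\mathcal{S}$ applies all these flips. For a partition $\mathcal{P}$ of $V(G)$, a $\mathcal{P}$-flip is $G\oplus\mathcal{S}$ with all pairs in $\mathcal{S}$ of the form $(X,Y)$, $X,Y\in\mathcal{P}$; a $k$-flip is a $\mathcal{P}$-flip with $|\mathcal{P}|\le k$. Flipper game of radius $r$ and width $k$: $G_0=G$, runner picks $v_0$; in round $i\ge1$ the flipper announces a $k$-flip $G_i$ of $G$, and then the runner moves to $v_i$ reachable from $v_{i-1}$ by a path of length at most $r$ in $G_{i-1}$. The flipper wins (the runner is caught) as soon as the current position $v_i$ is isolated in $G_i$, and the game ends then. A play is the sequence $(v_0,G_1,v_1,\ldots)$ produced; in particular in a play $(v_0,G_1,\ldots,v_{n-1},G_n)$, for each $0\le i\le n-1$ the vertex $v_i$ is not isolated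 in $G_i$. -}

module Defs where

open import Data.Nat using (ℕ; zero; suc; _≤_; _<_)
open import Data.Fin using (Fin; _≟_)
open import Data.Fin.Properties using (all?)
open import Data.Bool using (Bool; true; false; _xor_; _∧_; _∨_; if_then_else_)
import Data.Bool as B
open import Data.List using (List; []; _∷_; map)
open import Data.Product using (Σ; ∃; _×_; _,_; proj₁; proj₂)
open import Data.Sum using (_⊎_)
open import Data.Vec using (tabulate; lookup)
open import Data.Fin.Subset using (Subset; _∈_; _∉_; ∣_∣; Nonempty)
open import Relation.Nullary using (¬_; does)
open import Relation.Binary.PropositionalEquality using (_≡_)

Adj : ℕ → Set
Adj N = Fin N → Fin N → Bool

record IsGraph {N : ℕ} (G : Adj N) : Set where
  field
    symmetric : ∀ u v → G u v ≡ G v u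
    irreflexive : ∀ u → G u u ≡ false

flipAB : ∀ {N} → Adj N → Subset N → Subset N → Adj N
flipAB G A B u v =
  if does (u ≟ v) then G u v
  else (G u v xor ((lookup A u ∧ lookup B v) ∨ (lookup B u ∧ lookup A v)))

flipAll : ∀ {N} → Adj N → List (Subset N × Subset N) → Adj N
flipAll G [] = G
flipAll G ((A , B) ∷ S) = flipAB (flipAll G S) A B

-- a partition into at most k parts, given by a labelling p : Fin N → Fin k;
-- part i is the set of vertices labelled i
part : ∀ {N k} → (Fin N → Fin k) → Fin k → Subset N
part p i = tabulate (λ u → does (p u ≟ i))

IsPFlip : ∀ {N k} → (Fin N → Fin k) → Adj N → Adj N → Set
IsPFlip {N} {k} p G H =
  Σ (List (Fin k × Fin k)) λ S →
    ∀ u v → H u v ≡ flipAll G (map (λ xy → part p (proj₁ xy) , part p (proj₂ xy)) S) u v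

IsKFlip : ∀ {N} → ℕ → Adj N → Adj N → Set
IsKFlip {N} k G H = Σ (Fin N → Fin k) λ p → IsPFlip p G H

Isolated : ∀ {N} → Adj N → Fin N → Set
Isolated G v = ∀ w → G v w ≡ false

Reach : ∀ {N} → Adj N → ℕ → Fin N → Fin N → Set
Reach G zero u v = u ≡ v
Reach G (suc r) u v = Reach G r u v ⊎ ∃ λ w → Reach G r u w × G w v ≡ true

record Play {N : ℕ} (G : Adj N) (r k n : ℕ) : Set where
  field
    graphs : ℕ → Adj N          -- graphs i = G_i  (0 ≤ i ≤ n)
    pos : ℕ → Fin N             -- pos i = v_i     (0 ≤ i ≤ n-1)
    start : ∀ u v → graphs 0 u v ≡ G u v
    flips : ∀ i → 1 ≤ i → i ≤ n → IsKFlip k G (graphs i)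
    moves : ∀ j → suc j < n → Reach (graphs j) r (pos j) (pos (suc j))
    notCaught : ∀ i → i < n → ¬ Isolated (graphs i) (pos i)

isolatedSet : ∀ {N} → Adj N → Subset N
isolatedSet G = tabulate (λ v → does (all? (λ w → G v w B.≟ false)))

data ConnIn {N : ℕ} (G : Adj N) (S : Subset N) (u : Fin N) : Fin N → Set where
  here : u ∈ S → ConnIn G S u u
  step : ∀ {w v} → ConnIn G S u w → G w v ≡ true → v ∈ S → ConnIn G S u v

IsComponent : ∀ {N} → Adj N → Subset N → Set
IsComponent G S =
  Nonempty S
  × (∀ u v → u ∈ S → v ∈ S → ConnIn G S u v)
  × (∀ u w → u ∈ S → w ∉ S → G u w ≡ false)

{-# OPTIONS --safe #-}
module Submission where

-- The runner's last position v is not isolated in Gₘ, so it has a neighbour w ≠ v; both are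
-- within distance 2 of v and hence isolated in Gₘ₊₁, giving |S| ≥ 2. If |S| = 2 then S = {v, w}
-- is joined by an edge, and every neighbour of v or w is within distance 2 of v, hence in S.

open import Defs
open import Data.Nat using (ℕ; zero; suc; _≤_; _<_; z≤n; s≤s)
open import Data.Nat.Properties using (n≤1+n; ≤-refl; ≤-<-trans; <⇒≢)
open import Data.Fin using (Fin; _≟_)
open import Data.Fin.Properties using (all?; ¬∀⟶∃¬)
open import Data.Fin.Subset using (Subset; _∈_; _∉_; _⊆_; ∣_∣; ⁅_⁆; _∪_)
open import Data.Fin.Subset.Properties
  using (x∈⁅x⁆; x∈⁅y⁆⇒x≡y; x≢y⇒x∉⁅y⁆; ∣⁅x⁆∣≡1; p⊂q⇒∣p∣<∣q∣; x∈p∪q⁺; x∈p∪q⁻)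
open import Data.Vec using (lookup)
open import Data.Vec.Properties using (lookup∘tabulate; lookup⇒[]=)
open import Data.Bool using (true; false; _xor_; _∧_; _∨_)
import Data.Bool as B
open import Data.Bool.Properties using (∧-comm; ∨-comm; ¬-not)
open import Data.List using ([]; _∷_; map)
open import Data.Product using (∃; _×_; _,_; proj₁; proj₂)
open import Data.Sum using (_⊎_; inj₁; inj₂; [_,_])
open import Function using (_∘_)
open import Relation.Nullary using (¬_; yes; no; contradiction)
open import Relation.Nullary.Decidable using (dec-true)
open import Relation.Binary.PropositionalEquality
  using (_≡_; _≢_; refl; sym; trans; cong₂; subst)

IsGraph-cong : ∀ {N} {G H : Adj N} → (∀ u v → H u v ≡ G u v) → IsGraph G → IsGraph H
IsGraph-cong H≗G g = record
  { symmetric   = λ u v → trans (H≗G u v) (trans (IsGraph.symmetric g u v) (sym (H≗G v u)))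
  ; irreflexive = λ u → trans (H≗G u u) (IsGraph.irreflexive g u)
  }

flipAB-isGraph : ∀ {N} {G : Adj N} (A B : Subset N) → IsGraph G → IsGraph (flipAB G A B)
flipAB-isGraph {G = G} A B g = record { symmetric = symmetric′ ; irreflexive = irreflexive′ }
  where
  open IsGraph g

  toggle-symmetric : ∀ u v → (lookup A u ∧ lookup B v) ∨ (lookup B u ∧ lookup A v)
                           ≡ (lookup A v ∧ lookup B u) ∨ (lookup B v ∧ lookup A u)
  toggle-symmetric u v = trans (∨-comm (lookup A u ∧ lookup B v) _)
    (cong₂ _∨_ (∧-comm (lookup B u) (lookup A v)) (∧-comm (lookup A u) (lookup B v)))

  symmetric′ : ∀ u v → flipAB G A B u v ≡ flipAB G A B v u
  symmetric′ u v with u ≟ v | v ≟ u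
  ... | yes _    | yes _    = symmetric u v
  ... | yes refl | no v≢v   = contradiction refl v≢v
  ... | no u≢u   | yes refl = contradiction refl u≢u
  ... | no _     | no _     = cong₂ _xor_ (symmetric u v) (toggle-symmetric u v)

  irreflexive′ : ∀ u → flipAB G A B u u ≡ false
  irreflexive′ u with u ≟ u
  ... | yes _  = irreflexive u
  ... | no u≢u = contradiction refl u≢u

flipAll-isGraph : ∀ {N} {G : Adj N} S → IsGraph G → IsGraph (flipAll G S)
flipAll-isGraph []            g = g
flipAll-isGraph ((A , B) ∷ S) g = flipAB-isGraph A B (flipAll-isGraph S g)

kFlip-isGraph : ∀ {N k} {G H : Adj N} → IsGraph G → IsKFlip k G H → IsGraph H
kFlip-isGraph g (p , S , H≗flip) =
  IsGraph-cong H≗flip (flipAll-isGraph (map (λ ij → part p (proj₁ ij) , part p (proj₂ ij)) S) g)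

graphs-isGraph : ∀ {N r k n} {G : Adj N} → IsGraph G → (P : Play G r k n) →
                 ∀ i → i ≤ n → IsGraph (Play.graphs P i)
graphs-isGraph g P zero    _   = IsGraph-cong (Play.start P) g
graphs-isGraph g P (suc i) i<n = kFlip-isGraph g (Play.flips P (suc i) (s≤s z≤n) i<n)

neighbour-≢ : ∀ {N} {G : Adj N} {v w} → IsGraph G → G v w ≡ true → v ≢ w
neighbour-≢ g Gvw refl with trans (sym (IsGraph.irreflexive g _)) Gvw
... | ()

¬isolated⇒neighbour : ∀ {N} (G : Adj N) {v} → ¬ Isolated G v → ∃ λ w → G v w ≡ true
¬isolated⇒neighbour {N} G {v} ¬iso with ¬∀⟶∃¬ N (λ w → G v w ≡ false) (λ w → G v w B.≟ false) ¬iso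
... | w , Gvw≢false = w , ¬-not Gvw≢false

isolated⇒∈isolatedSet : ∀ {N} {G : Adj N} {v} → Isolated G v → v ∈ isolatedSet G
isolated⇒∈isolatedSet {G = G} {v} iso = lookup⇒[]= v _
  (trans (lookup∘tabulate _ v) (dec-true (all? (λ w → G v w B.≟ false)) iso))

Reach-refl : ∀ {N} (G : Adj N) r {u} → Reach G r u u
Reach-refl G zero    = refl
Reach-refl G (suc r) = inj₁ (Reach-refl G r)

Reach-step : ∀ {N} (G : Adj N) {r u w v} → Reach G r u w → G w v ≡ true → Reach G (suc r) u v
Reach-step G {w = w} u⇝w Gwv = inj₂ (w , u⇝w , Gwv)

x∈p⇒⁅x⁆⊆p : ∀ {n} {p : Subset n} {x} → x ∈ p → ⁅ x ⁆ ⊆ p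
x∈p⇒⁅x⁆⊆p {p = p} x∈p y∈⁅x⁆ = subst (_∈ p) (sym (x∈⁅y⁆⇒x≡y _ y∈⁅x⁆)) x∈p

x≢y⇒1<∣p∣ : ∀ {n} {p : Subset n} {x y} → x ≢ y → x ∈ p → y ∈ p → 1 < ∣ p ∣
x≢y⇒1<∣p∣ {x = x} x≢y x∈p y∈p = subst (_< _) (∣⁅x⁆∣≡1 x)
  (p⊂q⇒∣p∣<∣q∣ (x∈p⇒⁅x⁆⊆p x∈p , _ , y∈p , x≢y⇒x∉⁅y⁆ (x≢y ∘ sym)))

∣p∣≡2⇒∈-pair : ∀ {n} {p : Subset n} {x y z} → ∣ p ∣ ≡ 2 → x ≢ y → x ∈ p → y ∈ p → z ∈ p →
               z ≡ x ⊎ z ≡ y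
∣p∣≡2⇒∈-pair {p = p} {x} {y} {z} ∣p∣≡2 x≢y x∈p y∈p z∈p with z ≟ x | z ≟ y
... | yes z≡x | _       = inj₁ z≡x
... | no _    | yes z≡y = inj₂ z≡y
... | no z≢x  | no z≢y  = contradiction (sym ∣p∣≡2) (<⇒≢ (≤-<-trans 1<∣xy∣ ∣xy∣<∣p∣))
  where
  xy : Subset _
  xy = ⁅ x ⁆ ∪ ⁅ y ⁆
  1<∣xy∣ : 1 < ∣ xy ∣
  1<∣xy∣ = x≢y⇒1<∣p∣ x≢y (x∈p∪q⁺ (inj₁ (x∈⁅x⁆ x))) (x∈p∪q⁺ (inj₂ (x∈⁅x⁆ y)))
  xy⊆p : xy ⊆ p
  xy⊆p w∈xy = [ x∈p⇒⁅x⁆⊆p x∈p , x∈p⇒⁅x⁆⊆p y∈p ] (x∈p∪q⁻ ⁅ x ⁆ ⁅ y ⁆ w∈xy)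
  z∉xy : z ∉ xy
  z∉xy z∈xy = [ x≢y⇒x∉⁅y⁆ z≢x , x≢y⇒x∉⁅y⁆ z≢y ] (x∈p∪q⁻ ⁅ x ⁆ ⁅ y ⁆ z∈xy)
  ∣xy∣<∣p∣ : ∣ xy ∣ < ∣ p ∣
  ∣xy∣<∣p∣ = p⊂q⇒∣p∣<∣q∣ (xy⊆p , z , z∈p , z∉xy)

edge-isComponent : ∀ {N} {G : Adj N} {S : Subset N} {v w} → IsGraph G → G v w ≡ true →
                   (∀ x → Reach G 2 v x → x ∈ S) → (∀ u → u ∈ S → u ≡ v ⊎ u ≡ w) →
                   IsComponent G S
edge-isComponent {G = G} {S} {v} {w} g Gvw ball⊆S S⊆vw = (v , v∈S) , connected , closed
  where
  v∈S : v ∈ S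
  v∈S = ball⊆S v (Reach-refl G 2)
  w∈S : w ∈ S
  w∈S = ball⊆S w (Reach-step G (Reach-refl G 1) Gvw)
  Gwv : G w v ≡ true
  Gwv = trans (IsGraph.symmetric g w v) Gvw

  connected : ∀ u x → u ∈ S → x ∈ S → ConnIn G S u x
  connected u x u∈S x∈S with S⊆vw u u∈S | S⊆vw x x∈S
  ... | inj₁ refl | inj₁ refl = here v∈S
  ... | inj₁ refl | inj₂ refl = step (here v∈S) Gvw w∈S
  ... | inj₂ refl | inj₁ refl = step (here w∈S) Gwv v∈S
  ... | inj₂ refl | inj₂ refl = here w∈S

  closed : ∀ u x → u ∈ S → x ∉ S → G u x ≡ false
  closed u x u∈S x∉S with G u x in Gux
  ... | false = refl
  ... | true with S⊆vw u u∈S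
  ...   | inj₁ refl = contradiction (ball⊆S x (Reach-step G (Reach-refl G 1) Gux)) x∉S
  ...   | inj₂ refl = contradiction (ball⊆S x (Reach-step G (Reach-step G (Reach-refl G 0) Gvw) Gux)) x∉S

lemma3p1 : ∀ {N : ℕ} (G : Adj N) → IsGraph G → (m : ℕ) → (P : Play G 2 2 (suc m)) →
    (∀ w → Reach (Play.graphs P m) 2 (Play.pos P m) w → Isolated (Play.graphs P (suc m)) w) →
    2 ≤ ∣ isolatedSet (Play.graphs P (suc m)) ∣
    × (∣ isolatedSet (Play.graphs P (suc m)) ∣ ≡ 2 → IsComponent (Play.graphs P m) (isolatedSet (Play.graphs P (suc m))))
lemma3p1 {N} G g m P caught =
  x≢y⇒1<∣p∣ v≢w v∈S w∈S ,
  λ ∣S∣≡2 → edge-isComponent Gₘ-isGraph Gvw ball⊆S (λ u → ∣p∣≡2⇒∈-pair ∣S∣≡2 v≢w v∈S w∈S)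
  where
  open Play P
  Gₘ : Adj N
  Gₘ = graphs m
  S : Subset N
  S = isolatedSet (graphs (suc m))
  v : Fin N
  v = pos m
  Gₘ-isGraph : IsGraph Gₘ
  Gₘ-isGraph = graphs-isGraph g P m (n≤1+n m)
  neighbour : ∃ λ w → Gₘ v w ≡ true
  neighbour = ¬isolated⇒neighbour Gₘ (notCaught m ≤-refl)
  w : Fin N
  w = proj₁ neighbour
  Gvw : Gₘ v w ≡ true
  Gvw = proj₂ neighbour
  v≢w : v ≢ w
  v≢w = neighbour-≢ Gₘ-isGraph Gvw
  ball⊆S : ∀ x → Reach Gₘ 2 v x → x ∈ S
  ball⊆S x v⇝x = isolated⇒∈isolatedSet (caught x v⇝x)
  v∈S : v ∈ S
  v∈S = ball⊆S v (Reach-refl Gₘ 2)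
  w∈S : w ∈ S
  w∈S = ball⊆S w (Reach-step Gₘ (Reach-refl Gₘ 1) Gvw)
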